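{- Let $T$ be a tree of order $n \ge 3$ with diameter $D$. Then $\frac{d_k(T)}{d_{k+1}(T)} \le 2(n-D)$ for all $1 \le k < D$.
   Context: For a connected graph $G$, $d_i(G)$ denotes the number of unordered pairs of vertices of $G$ at distance exactly $i$. -}

module Defs where

open import Data.Nat using (ℕ; zero; suc; _+_; _≤_; _<ᵇ_)
open import Data.Bool using (Bool; true; false; _∧_; _∨_; not; if_then_else_)
open import Data.Fin using (Fin; toℕ; _≟_)
open import Data.List using (List; []; _∷_; _++_; [_]; length; map; allFin)
open import Data.Nat.ListAction using (sum)
open import Data.Bool.ListAction using (any)
open import Data.List.Relation.Unary.Unique.Propositional using (Unique)
open import Data.List.Relation.Unary.Linked using (Linked)
open import Data.Product using (Σ; ∃; _×_)
open import Relation.Nullary using (¬_)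
open import Relation.Nullary.Decidable using (⌊_⌋)
open import Relation.Binary.PropositionalEquality using (_≡_)

Graph : ℕ → Set
Graph n = Fin n → Fin n → Bool

module _ {n : ℕ} (G : Graph n) where

  Adj : Fin n → Fin n → Set
  Adj u v = G u v ≡ true

  IsSimple : Set
  IsSimple = (∀ u v → G u v ≡ G v u) × (∀ u → G u u ≡ false)

  -- reach k u v = true  iff there is a walk of length ≤ k from u to v
  reach : ℕ → Fin n → Fin n → Bool
  reach zero u v = ⌊ u ≟ v ⌋
  reach (suc k) u v = reach k u v ∨ any (λ w → reach k u w ∧ G w v) (allFin n)

  atDist : ℕ → Fin n → Fin n → Bool
  atDist zero u v = reach zero u v
  atDist (suc k) u v = reach (suc k) u v ∧ not (reach k u v)

  Connected : Set
  Connected = ∀ u v → ∃ λ k → reach k u v ≡ true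

  HasCycle : Set
  HasCycle = Σ (Fin n) λ x → Σ (List (Fin n)) λ xs →
    (2 ≤ length xs) × Unique (x ∷ xs) × Linked Adj (x ∷ xs ++ [ x ])

  IsTree : Set
  IsTree = IsSimple × Connected × ¬ HasCycle

  -- d k = number of unordered pairs {u,v} at distance exactly k
  d : ℕ → ℕ
  d k = sum (map (λ u → sum (map (λ v →
          if (toℕ u <ᵇ toℕ v) ∧ atDist k u v then 1 else 0) (allFin n))) (allFin n))

  IsDiameter : ℕ → Set
  IsDiameter D = (∃ λ u → ∃ λ v → atDist D u v ≡ true) × (∀ u v → reach D u v ≡ true)

module Submission where

-- Let T be a tree on n vertices and a, b two vertices at distance D (a diametral
-- pair).  For 1 ≤ k < D we show  d_k ≤ 2 (n − D) d_{k+1}  by double counting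
-- ordered pairs of vertices.  A pair (x, y) at distance k "charges" the pair
-- (x, q) at distance k + 1 whenever q is a neighbour of y, or y is off the a–b
-- path and q is any vertex at distance k + 1 from x (and symmetrically with the
-- roles of x and y exchanged).  Every pair at distance k charges something, and
-- a pair at distance k + 1 is charged at most 2 (1 + #off) times, where #off is
-- the number of vertices off the path; since the path has D + 1 vertices,
-- 1 + #off ≤ n − D.

open import Defs
open import Data.Nat using (ℕ; zero; suc; _+_; _*_; _∸_; _≤_; _<_; z≤n; s≤s; _≟_; _≤?_; _<ᵇ_)
open import Data.Nat.Properties
open import Data.Nat.ListAction using (sum)
open import Data.Bool using (Bool; true; false; _∧_; _∨_; not; if_then_else_; T)
open import Data.Bool.Properties using (T-≡; ∨-zeroʳ; ∧-zeroʳ; ∧-identityʳ) renaming (_≟_ to _≟ᵇ_)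
open import Data.Bool.ListAction using (any)
open import Data.Unit using (tt)
open import Data.Empty using (⊥; ⊥-elim)
open import Data.Sum using (_⊎_; inj₁; inj₂)
open import Data.Product using (∃; ∃₂; _×_; _,_; proj₁; proj₂)
open import Data.Fin using (Fin; zero; suc; toℕ)
open import Data.Fin.Properties using (toℕ-injective; toℕ<n; any?)
  renaming (_≟_ to _≟ᶠ_; suc-injective to sucᶠ-injective)
open import Data.List using (List; []; _∷_; _++_; [_]; length; map; tabulate; allFin)
open import Data.List.Properties using (length-++; length-++-≤ˡ; map-tabulate)
open import Data.List.Relation.Unary.All using (All; _∷_)
import Data.List.Relation.Unary.All as All
import Data.List.Relation.Unary.All.Properties as All
open import Data.List.Relation.Unary.AllPairs using ([]; _∷_)
open import Data.List.Relation.Unary.Any using (here; there; satisfied)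
open import Data.List.Relation.Unary.Any.Properties using (any⁺; any⁻)
open import Data.List.Relation.Unary.Linked using (Linked; [-]; _∷_)
open import Data.List.Relation.Unary.Unique.Propositional using (Unique)
import Data.List.Relation.Unary.Unique.Propositional.Properties as Unique
open import Data.List.Membership.Propositional using (_∈_; _∉_; lose)
open import Data.List.Membership.Propositional.Properties using (∈-allFin; ∈-++⁻)
open import Function using (_∘_; id)
open import Function.Bundles using (Equivalence)
open import Relation.Binary using (tri<; tri≈; tri>)
open import Relation.Binary.PropositionalEquality hiding ([_])
open import Relation.Nullary using (¬_; Dec; yes; no)
open import Relation.Nullary.Decidable using (⌊_⌋; _×-dec_; dec-true; dec-false; isYes≗does)
open import Algebra.Properties.CommutativeSemigroup +-commutativeSemigroup using (xy∙z≈xz∙y)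
open import Algebra.Properties.CommutativeSemigroup *-commutativeSemigroup
  using () renaming (x∙yz≈y∙xz to *-exchange)
open import Algebra.Properties.Semiring.Sum +-*-semiring
  using (sum-syntax; ∑-comm; ∑-distrib-+; *-distribˡ-sum; *-distribʳ-sum; sum-cong-≗)
  renaming (sum to ∑)

𝟙 : Bool → ℕ
𝟙 b = if b then 1 else 0

𝟙-∧ : ∀ b c → 𝟙 b * 𝟙 c ≡ 𝟙 (b ∧ c)
𝟙-∧ true c = +-identityʳ (𝟙 c)
𝟙-∧ false c = refl

𝟙-true : ∀ {b} → b ≡ true → ∀ m → 𝟙 b * m ≡ m
𝟙-true refl m = +-identityʳ m

𝟙*-≤ : ∀ b m → 𝟙 b * m ≤ m
𝟙*-≤ true m = ≤-reflexive (+-identityʳ m)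
𝟙*-≤ false m = z≤n

⌊⌋-true : ∀ {P : Set} (P? : Dec P) → P → ⌊ P? ⌋ ≡ true
⌊⌋-true P? p = trans (isYes≗does P?) (dec-true P? p)

⌊⌋-false : ∀ {P : Set} (P? : Dec P) → ¬ P → ⌊ P? ⌋ ≡ false
⌊⌋-false P? ¬p = trans (isYes≗does P?) (dec-false P? ¬p)

⌊⌋-sound : ∀ {P : Set} (P? : Dec P) → ⌊ P? ⌋ ≡ true → P
⌊⌋-sound (yes p) _ = p

-- Boolean case analysis that does not abstract the scrutinee, and ∧-elimination.
true-or-false : ∀ b → b ≡ true ⊎ b ≡ false
true-or-false true = inj₁ refl
true-or-false false = inj₂ refl

∧-true : ∀ {a b} → a ∧ b ≡ true → a ≡ true × b ≡ true
∧-true {true} {true} _ = refl , refl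

one-order : ∀ {a b} → a ≢ b → 𝟙 (a <ᵇ b) + 𝟙 (b <ᵇ a) ≡ 1
one-order {a} {b} a≢b with a <ᵇ b in a<b | b <ᵇ a in b<a
... | true | true = ⊥-elim (<-asym (<ᵇ⇒< a b (subst T (sym a<b) tt)) (<ᵇ⇒< b a (subst T (sym b<a) tt)))
... | true | false = refl
... | false | true = refl
... | false | false with <-cmp a b
...   | tri< a<b′ _ _ = ⊥-elim (subst T a<b (<⇒<ᵇ a<b′))
...   | tri≈ _ a≡b _ = ⊥-elim (a≢b a≡b)
...   | tri> _ _ b<a′ = ⊥-elim (subst T b<a (<⇒<ᵇ b<a′))

above⇒suc : ∀ {a b} → a < b → ∃ λ t → b ≡ suc t
above⇒suc {b = suc t} _ = t , refl

larger-summand⇒suc : ∀ {a b m} → a + b ≡ suc m → b ≤ a → ∃ λ t → a ≡ suc t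
larger-summand⇒suc {suc a} _ _ = a , refl
larger-summand⇒suc {zero} {zero} () _

≤?-zero : ∀ d → ⌊ d ≤? 0 ⌋ ≡ ⌊ d ≟ 0 ⌋
≤?-zero d with d ≟ 0
... | yes d≡0 = ⌊⌋-true (d ≤? 0) (≤-reflexive d≡0)
... | no d≢0 = ⌊⌋-false (d ≤? 0) (d≢0 ∘ n≤0⇒n≡0)

≤?-window : ∀ d j → ⌊ d ≤? suc j ⌋ ∧ not ⌊ d ≤? j ⌋ ≡ ⌊ d ≟ suc j ⌋
≤?-window d j with d ≟ suc j
... | yes refl rewrite ⌊⌋-true (suc j ≤? suc j) ≤-refl | ⌊⌋-false (suc j ≤? j) 1+n≰n = refl
... | no d≢ with d ≤? j
...   | yes _ = ∧-zeroʳ _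
...   | no d≰j =
  trans (∧-identityʳ _) (⌊⌋-false (d ≤? suc j) (λ d≤ → d≢ (≤-antisym d≤ (≰⇒> d≰j))))

δ : ∀ {n} → Fin n → Fin n → ℕ
δ i p = 𝟙 ⌊ i ≟ᶠ p ⌋

δ-refl : ∀ {n} (p : Fin n) → δ p p ≡ 1
δ-refl p with p ≟ᶠ p
... | yes _ = refl
... | no p≢p = ⊥-elim (p≢p refl)

δ-≢ : ∀ {n} {i p : Fin n} → i ≢ p → δ i p ≡ 0
δ-≢ {i = i} {p} i≢p with i ≟ᶠ p
... | yes i≡p = ⊥-elim (i≢p i≡p)
... | no _ = refl

∑-mono : ∀ {n} {f g : Fin n → ℕ} → (∀ i → f i ≤ g i) → ∑ f ≤ ∑ g
∑-mono {zero} _ = z≤n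
∑-mono {suc n} f≤g = +-mono-≤ (f≤g zero) (∑-mono (f≤g ∘ suc))

∑-point : ∀ {n} (f : Fin n → ℕ) i → f i ≤ ∑ f
∑-point f zero = m≤m+n _ _
∑-point f (suc i) = ≤-trans (∑-point (f ∘ suc) i) (m≤n+m _ _)

∑-ones : ∀ n → ∑[ i < n ] 1 ≡ n
∑-ones zero = refl
∑-ones (suc n) = cong suc (∑-ones n)

∑-zero : ∀ {n} (f : Fin n → ℕ) → (∀ i → f i ≡ 0) → ∑ f ≡ 0
∑-zero {zero} f _ = refl
∑-zero {suc n} f zeros = cong₂ _+_ (zeros zero) (∑-zero (f ∘ suc) (zeros ∘ suc))

∑-only : ∀ {n} (f : Fin n → ℕ) p → (∀ i → i ≢ p → f i ≡ 0) → ∑ f ≡ f p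
∑-only f zero vanish =
  trans (cong (f zero +_) (∑-zero (f ∘ suc) (λ i → vanish (suc i) λ ()))) (+-identityʳ _)
∑-only f (suc p) vanish =
  cong₂ _+_ (vanish zero λ ()) (∑-only (f ∘ suc) p (λ i i≢p → vanish (suc i) (i≢p ∘ sucᶠ-injective)))

∑-δ : ∀ {n} (p : Fin n) (f : Fin n → ℕ) → ∑[ i < n ] (δ i p * f i) ≡ f p
∑-δ p f = trans (∑-only (λ i → δ i p * f i) p (λ i i≢p → cong (_* f i) (δ-≢ i≢p)))
                (trans (cong (_* f p) (δ-refl p)) (+-identityʳ (f p)))

∑-atMostOne : ∀ {n} (b : Fin n → Bool) → (∀ i j → b i ≡ true → b j ≡ true → i ≡ j) →
  ∑[ i < n ] 𝟙 (b i) ≤ 1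
∑-atMostOne {zero} b unique = z≤n
∑-atMostOne {suc n} b unique with b zero in b₀
... | true = ≤-reflexive (cong suc (∑-zero _ rest-false))
  where
  rest-false : ∀ i → 𝟙 (b (suc i)) ≡ 0
  rest-false i with b (suc i) in bᵢ
  ... | true with () ← unique zero (suc i) b₀ bᵢ
  ... | false = refl
... | false = ∑-atMostOne (b ∘ suc) (λ i j bᵢ bⱼ → sucᶠ-injective (unique (suc i) (suc j) bᵢ bⱼ))

∑-injection : ∀ {m n} (f : Fin m → Fin n) → (∀ i j → f i ≡ f j → i ≡ j) →
  (P : Fin n → Bool) → (∀ i → P (f i) ≡ true) → m ≤ ∑[ x < n ] 𝟙 (P x)
∑-injection {m} {n} f injective P holds = begin
  m
    ≡⟨ ∑-ones m ⟨
  ∑[ i < m ] 1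
    ≡⟨ sum-cong-≗ pick ⟩
  ∑[ i < m ] ∑[ x < n ] (δ x (f i) * 𝟙 (P x))
    ≡⟨ ∑-comm (λ i x → δ x (f i) * 𝟙 (P x)) ⟩
  ∑[ x < n ] ∑[ i < m ] (δ x (f i) * 𝟙 (P x))
    ≡⟨ sum-cong-≗ (λ x → *-distribʳ-sum (𝟙 (P x)) (λ i → δ x (f i))) ⟨
  ∑[ x < n ] (∑[ i < m ] δ x (f i) * 𝟙 (P x))
    ≤⟨ ∑-mono (λ x → *-monoˡ-≤ (𝟙 (P x)) (preimage x)) ⟩
  ∑[ x < n ] (1 * 𝟙 (P x))
    ≡⟨ sum-cong-≗ (λ x → *-identityˡ (𝟙 (P x))) ⟩
  ∑[ x < n ] 𝟙 (P x) ∎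
  where
  open ≤-Reasoning
  pick : ∀ i → 1 ≡ ∑[ x < n ] (δ x (f i) * 𝟙 (P x))
  pick i = trans (cong 𝟙 (sym (holds i))) (sym (∑-δ (f i) (𝟙 ∘ P)))
  preimage : ∀ x → ∑[ i < m ] δ x (f i) ≤ 1
  preimage x = ∑-atMostOne (λ i → ⌊ x ≟ᶠ f i ⌋)
    (λ i j x≡fi x≡fj → injective i j
      (trans (sym (⌊⌋-sound (x ≟ᶠ f i) x≡fi)) (⌊⌋-sound (x ≟ᶠ f j) x≡fj)))

sum-allFin : ∀ {n} (f : Fin n → ℕ) → sum (map f (allFin n)) ≡ ∑ f
sum-allFin f = trans (cong sum (map-tabulate id f)) (sum-tabulate f)
  where
  sum-tabulate : ∀ {n} (f : Fin n → ℕ) → sum (tabulate f) ≡ ∑ f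
  sum-tabulate {zero} f = refl
  sum-tabulate {suc n} f = cong (f zero +_) (sum-tabulate (f ∘ suc))

any-allFin⁺ : ∀ {n} (p : Fin n → Bool) i → p i ≡ true → any p (allFin n) ≡ true
any-allFin⁺ p i pᵢ =
  Equivalence.to T-≡ (any⁺ p (lose (∈-allFin i) (Equivalence.from T-≡ pᵢ)))

any-allFin⁻ : ∀ {n} (p : Fin n → Bool) → any p (allFin n) ≡ true → ∃ λ i → p i ≡ true
any-allFin⁻ p found with satisfied (any⁻ p (allFin _) (Equivalence.from T-≡ found))
... | i , pᵢ = i , Equivalence.to T-≡ pᵢ

∑² : ∀ {n} → (Fin n → Fin n → ℕ) → ℕ
∑² {n} f = ∑[ x < n ] ∑[ y < n ] f x y

module _ {n : ℕ} where

  ∑²-cong : {f g : Fin n → Fin n → ℕ} → (∀ x y → f x y ≡ g x y) → ∑² f ≡ ∑² g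
  ∑²-cong f≡g = sum-cong-≗ (λ x → sum-cong-≗ (f≡g x))

  ∑²-mono : {f g : Fin n → Fin n → ℕ} → (∀ x y → f x y ≤ g x y) → ∑² f ≤ ∑² g
  ∑²-mono f≤g = ∑-mono (λ x → ∑-mono (f≤g x))

  ∑²-point : ∀ (f : Fin n → Fin n → ℕ) x y → f x y ≤ ∑² f
  ∑²-point f x y = ≤-trans (∑-point (f x) y) (∑-point (λ x → ∑ (f x)) x)

  ∑²-*ˡ : ∀ c (f : Fin n → Fin n → ℕ) → ∑² (λ x y → c * f x y) ≡ c * ∑² f
  ∑²-*ˡ c f = begin
    ∑² (λ x y → c * f x y)      ≡⟨ sum-cong-≗ (λ x → *-distribˡ-sum c (f x)) ⟨
    ∑[ x < n ] (c * ∑ (f x))    ≡⟨ *-distribˡ-sum c (λ x → ∑ (f x)) ⟨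
    c * ∑² f                    ∎
    where open ≡-Reasoning

  ∑²-+ : (f g : Fin n → Fin n → ℕ) → ∑² (λ x y → f x y + g x y) ≡ ∑² f + ∑² g
  ∑²-+ f g = trans (sum-cong-≗ (λ x → ∑-distrib-+ (f x) (g x)))
                   (∑-distrib-+ (λ x → ∑ (f x)) (λ x → ∑ (g x)))

  ∑²-transpose : (f : Fin n → Fin n → ℕ) → ∑² (λ x y → f y x) ≡ ∑² f
  ∑²-transpose f = ∑-comm (λ x y → f y x)

∑²-comm : ∀ {m n} (f : Fin m → Fin m → Fin n → Fin n → ℕ) →
  ∑² (λ x y → ∑² (f x y)) ≡ ∑² (λ p q → ∑² (λ x y → f x y p q))
∑²-comm {m} {n} f = begin
  ∑² (λ x y → ∑² (f x y))
    ≡⟨ sum-cong-≗ (λ x → ∑-comm (λ y p → ∑[ q < n ] f x y p q)) ⟩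
  ∑[ x < m ] ∑[ p < n ] ∑[ y < m ] ∑[ q < n ] f x y p q
    ≡⟨ ∑-comm (λ x p → ∑[ y < m ] ∑[ q < n ] f x y p q) ⟩
  ∑[ p < n ] ∑[ x < m ] ∑[ y < m ] ∑[ q < n ] f x y p q
    ≡⟨ sum-cong-≗ (λ p → sum-cong-≗ (λ x → ∑-comm (λ y q → f x y p q))) ⟩
  ∑[ p < n ] ∑[ x < m ] ∑[ q < n ] ∑[ y < m ] f x y p q
    ≡⟨ sum-cong-≗ (λ p → ∑-comm (λ x q → ∑[ y < m ] f x y p q)) ⟩
  ∑² (λ p q → ∑² (λ x y → f x y p q)) ∎
  where open ≡-Reasoning

double-counting : ∀ {m n} (α : Fin m → Fin m → Bool) (β : Fin n → Fin n → Bool)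
  (W : Fin m → Fin m → Fin n → Fin n → ℕ) (c : ℕ) →
  (∀ x y → α x y ≡ true → ∃₂ λ p q → β p q ≡ true × 1 ≤ W x y p q) →
  (∀ p q → β p q ≡ true → ∑² (λ x y → 𝟙 (α x y) * W x y p q) ≤ c) →
  ∑² (λ x y → 𝟙 (α x y)) ≤ c * ∑² (λ p q → 𝟙 (β p q))
double-counting α β W c covered load = begin
  ∑² (λ x y → 𝟙 (α x y))
    ≤⟨ ∑²-mono counted ⟩
  ∑² (λ x y → 𝟙 (α x y) * ∑² (λ p q → 𝟙 (β p q) * W x y p q))
    ≡⟨ ∑²-cong (λ x y → ∑²-*ˡ (𝟙 (α x y)) (λ p q → 𝟙 (β p q) * W x y p q)) ⟨
  ∑² (λ x y → ∑² (λ p q → 𝟙 (α x y) * (𝟙 (β p q) * W x y p q)))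
    ≡⟨ ∑²-comm (λ x y p q → 𝟙 (α x y) * (𝟙 (β p q) * W x y p q)) ⟩
  ∑² (λ p q → ∑² (λ x y → 𝟙 (α x y) * (𝟙 (β p q) * W x y p q)))
    ≡⟨ ∑²-cong (λ p q → trans (∑²-cong (λ x y → *-exchange (𝟙 (α x y)) (𝟙 (β p q)) _))
                               (∑²-*ˡ (𝟙 (β p q)) (λ x y → 𝟙 (α x y) * W x y p q))) ⟩
  ∑² (λ p q → 𝟙 (β p q) * ∑² (λ x y → 𝟙 (α x y) * W x y p q))
    ≤⟨ ∑²-mono bounded ⟩
  ∑² (λ p q → c * 𝟙 (β p q))
    ≡⟨ ∑²-*ˡ c (λ p q → 𝟙 (β p q)) ⟩
  c * ∑² (λ p q → 𝟙 (β p q)) ∎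
  where
  open ≤-Reasoning
  counted : ∀ x y → 𝟙 (α x y) ≤ 𝟙 (α x y) * ∑² (λ p q → 𝟙 (β p q) * W x y p q)
  counted x y with α x y in αxy
  ... | false = z≤n
  ... | true with covered x y αxy
  ...   | p , q , βpq , positive = begin
    1                                             ≤⟨ positive ⟩
    W x y p q                                     ≡⟨ 𝟙-true βpq (W x y p q) ⟨
    𝟙 (β p q) * W x y p q                         ≤⟨ ∑²-point (λ p q → 𝟙 (β p q) * W x y p q) p q ⟩
    ∑² (λ p q → 𝟙 (β p q) * W x y p q)            ≡⟨ 𝟙-true refl _ ⟨
    1 * ∑² (λ p q → 𝟙 (β p q) * W x y p q)        ∎
  bounded : ∀ p q → 𝟙 (β p q) * ∑² (λ x y → 𝟙 (α x y) * W x y p q) ≤ c * 𝟙 (β p q)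
  bounded p q with β p q in βpq
  ... | false = z≤n
  ... | true = begin
    1 * ∑² (λ x y → 𝟙 (α x y) * W x y p q)        ≡⟨ 𝟙-true refl _ ⟩
    ∑² (λ x y → 𝟙 (α x y) * W x y p q)            ≤⟨ load p q βpq ⟩
    c                                             ≡⟨ *-identityʳ c ⟨
    c * 1                                         ∎

-- least f B is the least k ≤ B with f k (and B if there is none).
least : (ℕ → Bool) → ℕ → ℕ
least f zero = 0
least f (suc B) = if f 0 then 0 else suc (least (f ∘ suc) B)

least-holds : ∀ (f : ℕ → Bool) B → f B ≡ true → f (least f B) ≡ true
least-holds f zero fB = fB
least-holds f (suc B) fB with f 0 in f₀
... | true = f₀
... | false = least-holds (f ∘ suc) B fB

least-minimal : ∀ (f : ℕ → Bool) B i → f i ≡ true → least f B ≤ i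
least-minimal f zero i fᵢ = z≤n
least-minimal f (suc B) i fᵢ with f 0 in f₀
least-minimal f (suc B) i fᵢ | true = z≤n
least-minimal f (suc B) zero fᵢ | false with () ← trans (sym fᵢ) f₀
least-minimal f (suc B) (suc i) fᵢ | false = s≤s (least-minimal (f ∘ suc) B i fᵢ)

module Distance {n : ℕ} (G : Graph n) (simple : IsSimple G) (connected : Connected G) where

  symmetric : ∀ u v → G u v ≡ G v u
  symmetric = proj₁ simple

  adjacent-distinct : ∀ {u v} → G u v ≡ true → u ≢ v
  adjacent-distinct {u} Guv refl with () ← trans (sym Guv) (proj₂ simple u)

  reach-zero : ∀ {u v} → reach G 0 u v ≡ true → u ≡ v
  reach-zero {u} {v} r with u ≟ᶠ v
  ... | yes u≡v = u≡v

  reach-refl : ∀ u → reach G 0 u u ≡ true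
  reach-refl u with u ≟ᶠ u
  ... | yes _ = refl
  ... | no u≢u = ⊥-elim (u≢u refl)

  reach-suc : ∀ k u v → reach G k u v ≡ true → reach G (suc k) u v ≡ true
  reach-suc k u v r rewrite r = refl

  reach-step : ∀ k u w v → reach G k u w ≡ true → G w v ≡ true → reach G (suc k) u v ≡ true
  reach-step k u w v r Gwv =
    trans (cong (reach G k u v ∨_) (any-allFin⁺ (λ w → reach G k u w ∧ G w v) w (cong₂ _∧_ r Gwv)))
          (∨-zeroʳ _)

  reach-inv : ∀ k u v → reach G (suc k) u v ≡ true →
    reach G k u v ≡ true ⊎ ∃ λ w → reach G k u w ≡ true × G w v ≡ true
  reach-inv k u v r with reach G k u v in short
  ... | true = inj₁ refl
  ... | false with any-allFin⁻ (λ w → reach G k u w ∧ G w v) r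
  ...   | w , found = inj₂ (w , ∧-true found)

  reach-mono : ∀ k l u v → k ≤ l → reach G k u v ≡ true → reach G l u v ≡ true
  reach-mono k l u v k≤l r with m≤n⇒∃[o]m+o≡n k≤l
  ... | o , refl = extend o
    where
    extend : ∀ o → reach G (k + o) u v ≡ true
    extend zero rewrite +-identityʳ k = r
    extend (suc o) rewrite +-suc k o = reach-suc (k + o) u v (extend o)

  reach-trans : ∀ a b u v w → reach G a u v ≡ true → reach G b v w ≡ true →
    reach G (a + b) u w ≡ true
  reach-trans a zero u v w r₁ r₂ rewrite reach-zero r₂ | +-identityʳ a = r₁
  reach-trans a (suc b) u v w r₁ r₂ rewrite +-suc a b with reach-inv b v w r₂
  ... | inj₁ r = reach-suc (a + b) u w (reach-trans a b u v w r₁ r)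
  ... | inj₂ (x , r , Gxw) = reach-step (a + b) u x w (reach-trans a b u v x r₁ r) Gxw

  reach-sym : ∀ k u v → reach G k u v ≡ true → reach G k v u ≡ true
  reach-sym zero u v r rewrite reach-zero r = reach-refl v
  reach-sym (suc k) u v r with reach-inv k u v r
  ... | inj₁ r′ = reach-suc k v u (reach-sym k u v r′)
  ... | inj₂ (w , r′ , Gwv) =
    reach-trans 1 k v w u (reach-step 0 v v w (reach-refl v) (trans (symmetric v w) Gwv)) (reach-sym k u w r′)

  dist : Fin n → Fin n → ℕ
  dist u v = least (λ k → reach G k u v) (proj₁ (connected u v))

  dist-reach : ∀ u v → reach G (dist u v) u v ≡ true
  dist-reach u v = least-holds (λ k → reach G k u v) (proj₁ (connected u v)) (proj₂ (connected u v))

  reach→dist : ∀ k u v → reach G k u v ≡ true → dist u v ≤ k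
  reach→dist k u v = least-minimal (λ k → reach G k u v) (proj₁ (connected u v)) k

  dist→reach : ∀ k u v → dist u v ≤ k → reach G k u v ≡ true
  dist→reach k u v le = reach-mono (dist u v) k u v le (dist-reach u v)

  reach≡dist≤ : ∀ k u v → reach G k u v ≡ ⌊ dist u v ≤? k ⌋
  reach≡dist≤ k u v with dist u v ≤? k | reach G k u v in r
  ... | yes d≤k | false = trans (sym r) (dist→reach k u v d≤k)
  ... | yes _ | true = refl
  ... | no d≰k | true = ⊥-elim (d≰k (reach→dist k u v r))
  ... | no _ | false = refl

  atDist≡dist : ∀ j u v → atDist G j u v ≡ ⌊ dist u v ≟ j ⌋
  atDist≡dist zero u v = trans (reach≡dist≤ 0 u v) (≤?-zero (dist u v))
  atDist≡dist (suc j) u v =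
    trans (cong₂ (λ r r′ → r ∧ not r′) (reach≡dist≤ (suc j) u v) (reach≡dist≤ j u v))
          (≤?-window (dist u v) j)

  dist-sym : ∀ u v → dist u v ≡ dist v u
  dist-sym u v = ≤-antisym (reach→dist (dist v u) u v (reach-sym (dist v u) v u (dist-reach v u)))
                           (reach→dist (dist u v) v u (reach-sym (dist u v) u v (dist-reach u v)))

  dist-triangle : ∀ u v w → dist u w ≤ dist u v + dist v w
  dist-triangle u v w =
    reach→dist (dist u v + dist v w) u w (reach-trans (dist u v) (dist v w) u v w (dist-reach u v) (dist-reach v w))

  dist-refl : ∀ u → dist u u ≡ 0
  dist-refl u = n≤0⇒n≡0 (reach→dist 0 u u (reach-refl u))

  dist-zero : ∀ {u v} → dist u v ≡ 0 → u ≡ v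
  dist-zero {u} {v} d≡0 = reach-zero (dist→reach 0 u v (≤-reflexive d≡0))

  dist-adjacent : ∀ {u v} → G u v ≡ true → dist u v ≡ 1
  dist-adjacent {u} {v} Guv with dist u v in d | reach→dist 1 u v (reach-step 0 u u v (reach-refl u) Guv)
  ... | zero | _ = ⊥-elim (adjacent-distinct Guv (dist-zero d))
  ... | suc zero | _ = refl
  ... | suc (suc _) | s≤s ()

  dist-suc : ∀ {u v} → u ≢ v → ∃ λ t → dist u v ≡ suc t
  dist-suc {u} {v} u≢v with dist u v in duv
  ... | zero = ⊥-elim (u≢v (dist-zero duv))
  ... | suc t = t , refl

  dist-neighbour : ∀ x {w v} → G w v ≡ true → dist x v ≤ suc (dist x w)
  dist-neighbour x {w} {v} Gwv = ≤-trans (dist-triangle x w v)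
    (≤-reflexive (trans (cong (dist x w +_) (dist-adjacent Gwv)) (+-comm _ 1)))

  parent : ∀ x {v t} → dist x v ≡ suc t → ∃ λ w → G w v ≡ true × dist x w ≡ t
  parent x {v} {t} d≡ with reach-inv t x v (dist→reach (suc t) x v (≤-reflexive d≡))
  ... | inj₁ r = ⊥-elim (1+n≰n (≤-trans (≤-reflexive (sym d≡)) (reach→dist t x v r)))
  ... | inj₂ (w , r , Gwv) = w , Gwv , ≤-antisym (reach→dist t x w r)
        (≤-pred (≤-trans (≤-reflexive (sym d≡)) (dist-neighbour x Gwv)))

  geodesic-split : ∀ o j r z → dist o z ≡ j + r → ∃ λ w → dist o w ≡ j × dist w z ≡ r
  geodesic-split o j zero z d≡ = z , trans d≡ (+-identityʳ j) , dist-refl z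
  geodesic-split o j (suc r) z d≡ with parent o (trans d≡ (+-suc j r))
  ... | p , Gpz , dop with geodesic-split o j r p dop
  ...   | w , dow , dwp = w , dow , ≤-antisym upper lower
    where
    upper : dist w z ≤ suc r
    upper = ≤-trans (dist-neighbour w Gpz) (≤-reflexive (cong suc dwp))
    lower : suc r ≤ dist w z
    lower = +-cancelˡ-≤ j (suc r) (dist w z) (begin
      j + suc r             ≡⟨ d≡ ⟨
      dist o z              ≤⟨ dist-triangle o w z ⟩
      dist o w + dist w z   ≡⟨ cong (_+ dist w z) dow ⟩
      j + dist w z          ∎)
      where open ≤-Reasoning

  vertex-at-distance : ∀ u v j → j ≤ dist u v → ∃ λ z → dist u z ≡ j
  vertex-at-distance u v j j≤d with geodesic-split u j (dist u v ∸ j) v (sym (m+[n∸m]≡n j≤d))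
  ... | z , duz , _ = z , duz

  ordered : ℕ → ℕ
  ordered j = ∑² (λ u v → 𝟙 ⌊ dist u v ≟ j ⌋)

  ordered≡2d : ∀ j → 1 ≤ j → ordered j ≡ d G j + d G j
  ordered≡2d j 1≤j = begin
    ordered j                                ≡⟨ ∑²-cong split ⟩
    ∑² (λ u v → below u v + below v u)       ≡⟨ ∑²-+ (λ u v → below u v) (λ u v → below v u) ⟩
    ∑² below + ∑² (λ u v → below v u)        ≡⟨ cong (∑² below +_) (∑²-transpose below) ⟩
    ∑² below + ∑² below                      ≡⟨ cong₂ _+_ d≡ d≡ ⟨
    d G j + d G j                            ∎
    where
    open ≡-Reasoning
    below : Fin n → Fin n → ℕ
    below u v = 𝟙 ((toℕ u <ᵇ toℕ v) ∧ atDist G j u v)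
    d≡ : d G j ≡ ∑² below
    d≡ = trans (sum-allFin (λ u → sum (map (below u) (allFin n)))) (sum-cong-≗ (λ u → sum-allFin (below u)))
    split : ∀ u v → 𝟙 ⌊ dist u v ≟ j ⌋ ≡ below u v + below v u
    split u v rewrite atDist≡dist j u v | atDist≡dist j v u | dist-sym v u with dist u v ≟ j
    ... | no _ rewrite ∧-zeroʳ (toℕ u <ᵇ toℕ v) | ∧-zeroʳ (toℕ v <ᵇ toℕ u) = refl
    ... | yes duv≡j rewrite ∧-identityʳ (toℕ u <ᵇ toℕ v) | ∧-identityʳ (toℕ v <ᵇ toℕ u) =
      sym (one-order (u≢v ∘ toℕ-injective))
      where
      u≢v : u ≢ v
      u≢v refl = <-irrefl (trans (sym (dist-refl u)) duv≡j) 1≤j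

linked-snoc : ∀ {A : Set} {R : A → A → Set} xs b c →
  Linked R (xs ++ [ b ]) → R b c → Linked R ((xs ++ [ b ]) ++ [ c ])
linked-snoc [] b c [-] Rbc = Rbc ∷ [-]
linked-snoc (a ∷ []) b c (Rab ∷ [-]) Rbc = Rab ∷ Rbc ∷ [-]
linked-snoc (a ∷ a′ ∷ xs) b c (Raa′ ∷ rest) Rbc = Raa′ ∷ linked-snoc (a′ ∷ xs) b c rest Rbc

unique-snoc : ∀ {A : Set} {xs : List A} {c} → Unique xs → c ∉ xs → Unique (xs ++ [ c ])
unique-snoc {c = c} u c∉xs = Unique.++⁺ u (All.[] ∷ []) disjoint
  where
  disjoint : ∀ {v} → ¬ (v ∈ _ × v ∈ [ c ])
  disjoint (v∈xs , here refl) = c∉xs v∈xs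

module Tree {n : ℕ} (G : Graph n) (tree : IsTree G) where

  open import Data.List.Membership.DecPropositional (_≟ᶠ_ {n}) using (_∈?_)
  open Distance G (proj₁ tree) (proj₁ (proj₂ tree)) public

  acyclic : ¬ HasCycle G
  acyclic = proj₂ (proj₂ tree)

  record Arch (x u w : Fin n) : Set where
    field
      inner    : List (Fin n)
      nonempty : 1 ≤ length inner
      distinct : Unique (u ∷ inner ++ [ w ])
      linked   : Linked (Adj G) (u ∷ inner ++ [ w ])
      high     : All (λ c → dist x u ≤ dist x c × dist x w ≤ dist x c) inner

  locate : ∀ {p u w : Fin n} inner → p ∈ (u ∷ inner ++ [ w ]) → p ≡ u ⊎ p ∈ inner ⊎ p ≡ w
  locate inner (here p≡u) = inj₁ p≡u
  locate inner (there p∈) with ∈-++⁻ inner p∈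
  ... | inj₁ p∈inner = inj₂ (inj₁ p∈inner)
  ... | inj₂ (here p≡w) = inj₂ (inj₂ p≡w)

  arch-closed : ∀ {x u w} → Arch x u w → G w u ≡ true → ⊥
  arch-closed {u = u} {w} A Gwu =
    acyclic (u , inner ++ [ w ] , two , distinct , linked-snoc (u ∷ inner) w u linked Gwu)
    where
    open Arch A
    two : 2 ≤ length (inner ++ [ w ])
    two = subst (2 ≤_) (sym (trans (length-++ inner) (+-comm (length inner) 1))) (s≤s nonempty)

  lower-start : ∀ {x u w t} → Arch x u w → dist x w ≤ dist x u → dist x u ≡ suc t →
    ∃ λ p → dist x p ≡ t × Arch x p w
  lower-start {x} {u} {w} {t} A w≤u du with parent x du
  ... | p , Gpu , dp with p ∈? (u ∷ Arch.inner A ++ [ w ])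
  ...   | yes p∈ = ⊥-elim (stuck (locate (Arch.inner A) p∈))
    where
    open Arch A
    stuck : p ≡ u ⊎ p ∈ inner ⊎ p ≡ w → ⊥
    stuck (inj₁ p≡u) = adjacent-distinct Gpu p≡u
    stuck (inj₂ (inj₁ p∈inner)) =
      1+n≰n (subst (_≤ t) du (subst (dist x u ≤_) dp (proj₁ (All.lookup high p∈inner))))
    stuck (inj₂ (inj₂ refl)) = arch-closed A Gpu
  ...   | no p∉ = p , dp , record
    { inner = u ∷ inner
    ; nonempty = s≤s z≤n
    ; distinct = All.¬Any⇒All¬ _ p∉ ∷ distinct
    ; linked = Gpu ∷ linked
    ; high = (p≤u , w≤u) ∷ All.map (λ (u≤c , w≤c) → ≤-trans p≤u u≤c , w≤c) high
    }
    where
    open Arch A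
    p≤u : dist x p ≤ dist x u
    p≤u = ≤-trans (≤-reflexive dp) (≤-trans (n≤1+n t) (≤-reflexive (sym du)))

  lower-end : ∀ {x u w t} → Arch x u w → dist x u < dist x w → dist x w ≡ suc t →
    ∃ λ p → dist x p ≡ t × Arch x u p
  lower-end {x} {u} {w} {t} A u<w dw with parent x dw
  ... | p , Gpw , dp with p ∈? (u ∷ Arch.inner A ++ [ w ])
  ...   | yes p∈ = ⊥-elim (stuck (locate (Arch.inner A) p∈))
    where
    open Arch A
    stuck : p ≡ u ⊎ p ∈ inner ⊎ p ≡ w → ⊥
    stuck (inj₁ refl) = arch-closed A (trans (symmetric w p) Gpw)
    stuck (inj₂ (inj₁ p∈inner)) =
      1+n≰n (subst (_≤ t) dw (subst (dist x w ≤_) dp (proj₂ (All.lookup high p∈inner))))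
    stuck (inj₂ (inj₂ p≡w)) = adjacent-distinct Gpw p≡w
  ...   | no p∉ = p , dp , record
    { inner = inner ++ [ w ]
    ; nonempty = ≤-trans nonempty (length-++-≤ˡ inner)
    ; distinct = unique-snoc distinct p∉
    ; linked = linked-snoc (u ∷ inner) w p linked (trans (symmetric w p) Gpw)
    ; high = All.++⁺ (All.map (λ (u≤c , w≤c) → u≤c , ≤-trans p≤w w≤c) high)
                     ((<⇒≤ u<w , p≤w) ∷ All.[])
    }
    where
    open Arch A
    p≤w : dist x p ≤ dist x w
    p≤w = ≤-trans (≤-reflexive dp) (≤-trans (n≤1+n t) (≤-reflexive (sym dw)))

  -- Trees have no arches: lowering the farther end decreases  dist x u + dist x w
  -- until both ends are x, contradicting distinctness.
  no-arch : ∀ m {x u w} → dist x u + dist x w ≡ m → Arch x u w → ⊥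
  no-arch zero {x} {u} {w} d≡0 A with Arch.distinct A
  ... | u∉ ∷ _ = All.lookup u∉ (∈-last (Arch.inner A))
                   (trans (sym (dist-zero (m+n≡0⇒m≡0 _ d≡0))) (dist-zero (m+n≡0⇒n≡0 (dist x u) d≡0)))
    where
    ∈-last : ∀ (xs : List (Fin n)) → w ∈ xs ++ [ w ]
    ∈-last [] = here refl
    ∈-last (_ ∷ xs) = there (∈-last xs)
  no-arch (suc m) {x} {u} {w} d≡ A with dist x w ≤? dist x u
  ... | yes w≤u with lower-start A w≤u (proj₂ (larger-summand⇒suc d≡ w≤u))
  ...   | p , dp , A′ = no-arch m (+-cancelˡ-≡ 1 _ _ (begin
    suc (dist x p + dist x w)   ≡⟨ cong (λ e → suc e + dist x w) dp ⟩
    suc t + dist x w            ≡⟨ cong (_+ dist x w) (proj₂ (larger-summand⇒suc d≡ w≤u)) ⟨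
    dist x u + dist x w         ≡⟨ d≡ ⟩
    suc m                       ∎)) A′
    where
    open ≡-Reasoning
    t = proj₁ (larger-summand⇒suc d≡ w≤u)
  no-arch (suc m) {x} {u} {w} d≡ A | no w≰u with lower-end A (≰⇒> w≰u) (proj₂ (above⇒suc (≰⇒> w≰u)))
  ...   | p , dp , A′ = no-arch m (+-cancelˡ-≡ 1 _ _ (begin
    suc (dist x u + dist x p)   ≡⟨ +-suc (dist x u) (dist x p) ⟨
    dist x u + suc (dist x p)   ≡⟨ cong (λ e → dist x u + suc e) dp ⟩
    dist x u + suc t            ≡⟨ cong (dist x u +_) (proj₂ (above⇒suc (≰⇒> w≰u))) ⟨
    dist x u + dist x w         ≡⟨ d≡ ⟩
    suc m                       ∎)) A′
    where
    open ≡-Reasoning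
    t = proj₁ (above⇒suc (≰⇒> w≰u))

  descent-unique : ∀ x v {w₁ w₂} → G w₁ v ≡ true → G w₂ v ≡ true →
    dist x w₁ ≤ dist x v → dist x w₂ ≤ dist x v → w₁ ≡ w₂
  descent-unique x v {w₁} {w₂} Gw₁v Gw₂v w₁≤v w₂≤v with w₁ ≟ᶠ w₂
  ... | yes w₁≡w₂ = w₁≡w₂
  ... | no w₁≢w₂ = ⊥-elim (no-arch _ refl record
    { inner = [ v ]
    ; nonempty = s≤s z≤n
    ; distinct = (adjacent-distinct Gw₁v ∷ w₁≢w₂ ∷ All.[])
               ∷ (adjacent-distinct Gw₂v ∘ sym ∷ All.[]) ∷ All.[] ∷ []
    ; linked = Gw₁v ∷ trans (symmetric v w₂) Gw₂v ∷ [-]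
    ; high = (w₁≤v , w₂≤v) ∷ All.[]
    })

  edge-step : ∀ x {u v} → G u v ≡ true → dist x v ≡ suc (dist x u) ⊎ dist x u ≡ suc (dist x v)
  edge-step x {u} {v} Guv with <-cmp (dist x u) (dist x v)
  ... | tri< u<v _ _ = inj₁ (≤-antisym (dist-neighbour x Guv) u<v)
  ... | tri> _ _ v<u = inj₂ (≤-antisym (dist-neighbour x (trans (symmetric v u) Guv)) v<u)
  ... | tri≈ _ u≡v _ with dist x u in du
  ...   | zero = ⊥-elim (adjacent-distinct Guv (trans (sym (dist-zero du)) (dist-zero (sym u≡v))))
  ...   | suc t with parent x du
  ...     | p , Gpu , dp with descent-unique x u Gpu (trans (symmetric v u) Guv)
                             (subst (dist x p ≤_) (sym du) (≤-trans (≤-reflexive dp) (n≤1+n t)))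
                             (≤-reflexive (trans (sym u≡v) (sym du)))
  ...       | refl = ⊥-elim (1+n≰n (≤-reflexive (trans u≡v dp)))

  -- Walk from y towards x.  Once a step moves away from c, every later step does
  -- too (a tree has no "valleys"), so y lies on a shortest c–x path.
  away-from : ∀ m c x {y y′} → dist x y ≡ suc m → G y′ y ≡ true → dist x y′ ≡ m →
    dist c y′ ≡ suc (dist c y) → dist c x ≡ dist c y + suc m
  away-from zero c x {y} {y′} _ _ dy′ away rewrite dist-zero dy′ = trans away (+-comm 1 (dist c y))
  away-from (suc m) c x {y} {y′} dy Gy′y dy′ away with parent x dy′
  ... | y″ , Gy″y′ , dy″ with edge-step c Gy″y′
  ...   | inj₂ away′ = begin
    dist c x                   ≡⟨ away-from m c x dy′ Gy″y′ dy″ away′ ⟩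
    dist c y′ + suc m          ≡⟨ cong (_+ suc m) away ⟩
    suc (dist c y) + suc m     ≡⟨ +-suc (dist c y) (suc m) ⟨
    dist c y + suc (suc m)     ∎
    where open ≡-Reasoning
  ...   | inj₁ towards with descent-unique c y′ (trans (symmetric y y′) Gy′y) Gy″y′
                          (≤-trans (n≤1+n _) (≤-reflexive (sym away)))
                          (≤-trans (n≤1+n _) (≤-reflexive (sym towards)))
  ...     | refl = ⊥-elim (1+n≰n (≤-trans (≤-reflexive (sym dy)) (≤-trans (≤-reflexive dy″) (n≤1+n m))))

  -- The four-point condition of tree metrics (in the form needed here).
  four-point : ∀ a b x y →
    dist a b + dist x y ≤ dist a x + dist b y ⊎ dist a b + dist x y ≤ dist a y + dist b x
  four-point a b x y = along (dist x y) y refl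
    where
    open ≤-Reasoning
    along : ∀ m y → dist x y ≡ m →
      dist a b + m ≤ dist a x + dist b y ⊎ dist a b + m ≤ dist a y + dist b x
    along zero y dy rewrite dist-zero dy = inj₁ (begin
      dist a b + 0           ≡⟨ +-identityʳ (dist a b) ⟩
      dist a b               ≤⟨ dist-triangle a y b ⟩
      dist a y + dist y b    ≡⟨ cong (dist a y +_) (dist-sym y b) ⟩
      dist a y + dist b y    ∎)
    along (suc m) y dy with parent x dy
    ... | y′ , Gy′y , dy′ with edge-step a Gy′y | edge-step b Gy′y
    ...   | inj₂ away | _ = inj₁ (begin
      dist a b + suc m                ≤⟨ +-monoˡ-≤ (suc m) (dist-triangle a y b) ⟩
      dist a y + dist y b + suc m     ≡⟨ xy∙z≈xz∙y (dist a y) (dist y b) (suc m) ⟩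
      dist a y + suc m + dist y b     ≡⟨ cong₂ _+_ (sym (away-from m a x dy Gy′y dy′ away)) (dist-sym y b) ⟩
      dist a x + dist b y             ∎)
    ...   | inj₁ _ | inj₂ away = inj₂ (begin
      dist a b + suc m                ≤⟨ +-monoˡ-≤ (suc m) (dist-triangle a y b) ⟩
      dist a y + dist y b + suc m     ≡⟨ +-assoc (dist a y) (dist y b) (suc m) ⟩
      dist a y + (dist y b + suc m)   ≡⟨ cong (dist a y +_) (trans (cong (_+ suc m) (dist-sym y b))
                                            (sym (away-from m b x dy Gy′y dy′ away))) ⟩
      dist a y + dist b x             ∎)
    ...   | inj₁ towards-a | inj₁ towards-b with along m y′ dy′
    ...     | inj₁ le = inj₁ (begin
      dist a b + suc m                ≡⟨ +-suc (dist a b) m ⟩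
      suc (dist a b + m)              ≤⟨ s≤s le ⟩
      suc (dist a x + dist b y′)      ≡⟨ +-suc (dist a x) (dist b y′) ⟨
      dist a x + suc (dist b y′)      ≡⟨ cong (dist a x +_) towards-b ⟨
      dist a x + dist b y             ∎)
    ...     | inj₂ le = inj₂ (begin
      dist a b + suc m                ≡⟨ +-suc (dist a b) m ⟩
      suc (dist a b + m)              ≤⟨ s≤s le ⟩
      suc (dist a y′ + dist b x)      ≡⟨ cong (_+ dist b x) towards-a ⟨
      dist a y + dist b x             ∎)

module Diametral {n : ℕ} (G : Graph n) (tree : IsTree G) (a b : Fin n) (D : ℕ)
                 (dab : Tree.dist G tree a b ≡ D) where

  open Tree G tree

  -- x lies on the a–b path iff  dist a x + dist x b = D.
  onPath : Fin n → Bool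
  onPath x = ⌊ dist a x + dist x b ≟ D ⌋

  -- An inner vertex y of the path has, for every x, a neighbour farther from x:
  -- its two path neighbours cannot both be closer to x.
  inner-extends : ∀ {y} → onPath y ≡ true → y ≢ a → y ≢ b →
    ∀ x → ∃ λ c → G y c ≡ true × dist x c ≡ suc (dist x y)
  inner-extends {y} on y≢a y≢b x with dist-suc (y≢a ∘ sym) | dist-suc (y≢b ∘ sym)
  ... | s , day | t , dby with parent a day | parent b dby
  ...   | p , Gpy , dap | q , Gqy , dbq with edge-step x Gpy | edge-step x Gqy
  ...     | inj₂ farther | _ = p , trans (symmetric y p) Gpy , farther
  ...     | inj₁ _ | inj₂ farther = q , trans (symmetric y q) Gqy , farther
  ...     | inj₁ p-closer | inj₁ q-closer
    with descent-unique x y Gpy Gqy (≤-trans (n≤1+n _) (≤-reflexive (sym p-closer)))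
                                    (≤-trans (n≤1+n _) (≤-reflexive (sym q-closer)))
  ...       | refl = ⊥-elim (<-irrefl refl (begin-strict
    D                               ≡⟨ dab ⟨
    dist a b                        ≤⟨ dist-triangle a p b ⟩
    dist a p + dist p b             ≡⟨ cong₂ _+_ dap (trans (dist-sym p b) dbq) ⟩
    s + t                           <⟨ +-mono-< (n<1+n s) (n<1+n t) ⟩
    suc s + suc t                   ≡⟨ cong₂ _+_ day (trans (dist-sym y b) dby) ⟨
    dist a y + dist y b             ≡⟨ ⌊⌋-sound (dist a y + dist y b ≟ D) on ⟩
    D                               ∎))
    where open ≤-Reasoning

  #off : ℕ
  #off = ∑[ x < n ] 𝟙 (not (onPath x))

  -- The path has a vertex at each distance j ≤ D from a, so at least D + 1 vertices.
  off-path-bound : suc #off ≤ n ∸ D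
  off-path-bound = m+n≤o⇒m≤o∸n (suc #off) (subst (_≤ n) (+-suc #off D) (begin
    #off + suc D
      ≤⟨ +-monoʳ-≤ #off (∑-injection vertex injective onPath on-path) ⟩
    #off + ∑[ x < n ] 𝟙 (onPath x)
      ≡⟨ ∑-distrib-+ (λ x → 𝟙 (not (onPath x))) (λ x → 𝟙 (onPath x)) ⟨
    ∑[ x < n ] (𝟙 (not (onPath x)) + 𝟙 (onPath x))
      ≡⟨ sum-cong-≗ (λ x → one (onPath x)) ⟩
    ∑[ x < n ] 1
      ≡⟨ ∑-ones n ⟩
    n ∎))
    where
    open ≤-Reasoning
    one : ∀ β → 𝟙 (not β) + 𝟙 β ≡ 1
    one true = refl
    one false = refl
    j≤D : ∀ (j : Fin (suc D)) → toℕ j ≤ D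
    j≤D j = ≤-pred (toℕ<n j)
    split : ∀ (j : Fin (suc D)) → ∃ λ w → dist a w ≡ toℕ j × dist w b ≡ D ∸ toℕ j
    split j = geodesic-split a (toℕ j) (D ∸ toℕ j) b (trans dab (sym (m+[n∸m]≡n (j≤D j))))
    vertex : Fin (suc D) → Fin n
    vertex j = proj₁ (split j)
    injective : ∀ i j → vertex i ≡ vertex j → i ≡ j
    injective i j vi≡vj = toℕ-injective (trans (sym (proj₁ (proj₂ (split i))))
                                          (trans (cong (dist a) vi≡vj) (proj₁ (proj₂ (split j)))))
    on-path : ∀ j → onPath (vertex j) ≡ true
    on-path j = ⌊⌋-true (_ ≟ D) (trans (cong₂ _+_ (proj₁ (proj₂ (split j))) (proj₂ (proj₂ (split j))))
                                       (m+[n∸m]≡n (j≤D j)))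

  module Charging (k : ℕ) (1≤k : 1 ≤ k) (k<D : k < D) where

    Far : Fin n → Set
    Far u = ∃ λ z → dist u z ≡ suc k

    far? : ∀ u → Dec (Far u)
    far? u = any? (λ z → dist u z ≟ suc k)

    Extends : Fin n → Fin n → Set
    Extends x y = ∃ λ c → G y c ≡ true × dist x c ≡ suc k

    extends? : ∀ x y → Dec (Extends x y)
    extends? x y = any? (λ c → (G y c ≟ᵇ true) ×-dec (dist x c ≟ suc k))

    Endpoint : Fin n → Set
    Endpoint u = u ≡ a ⊎ u ≡ b

    endpoint-far : ∀ {u} → Endpoint u → Far u
    endpoint-far (inj₁ refl) = vertex-at-distance a b (suc k) (subst (suc k ≤_) (sym dab) k<D)
    endpoint-far (inj₂ refl) = vertex-at-distance b a (suc k) (subst (suc k ≤_) (sym (trans (dist-sym b a) dab)) k<D)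

    ends-apart : ∀ {x y} → dist x y ≡ k → Endpoint x → Endpoint y → ⊥
    ends-apart {x} dxy (inj₁ refl) (inj₁ refl) = <-irrefl (trans (sym (dist-refl x)) dxy) 1≤k
    ends-apart {x} dxy (inj₂ refl) (inj₂ refl) = <-irrefl (trans (sym (dist-refl x)) dxy) 1≤k
    ends-apart dxy (inj₁ refl) (inj₂ refl) = <-irrefl (trans (sym dxy) dab) k<D
    ends-apart dxy (inj₂ refl) (inj₁ refl) = <-irrefl (trans (sym dxy) (trans (dist-sym b a) dab)) k<D

    stuck-on-path : ∀ {x y} → dist x y ≡ k → onPath y ≡ true → ¬ Extends x y → Endpoint y
    stuck-on-path {x} {y} dxy on stuck with y ≟ᶠ a | y ≟ᶠ b
    ... | yes y≡a | _ = inj₁ y≡a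
    ... | no _ | yes y≡b = inj₂ y≡b
    ... | no y≢a | no y≢b with inner-extends on y≢a y≢b x
    ...   | c , Gyc , dxc = ⊥-elim (stuck (c , Gyc , trans dxc (cong suc dxy)))

    near : ∀ {u} → ¬ Far u → ∀ o → dist o u ≤ k
    near {u} u-near o with dist o u ≤? k
    ... | yes ≤k = ≤k
    ... | no ≰k = ⊥-elim (u-near (vertex-at-distance u o (suc k) (subst (suc k ≤_) (dist-sym o u) (≰⇒> ≰k))))

    too-close : ∀ {x y e f} → dist x y ≡ k → dist a b + dist x y ≤ e + f → e ≤ k → f ≤ k → ⊥
    too-close dxy le e≤k f≤k = <⇒≱ k<D (+-cancelʳ-≤ k D k
      (≤-trans (≤-reflexive (cong₂ _+_ (sym dab) (sym dxy))) (≤-trans le (+-mono-≤ e≤k f≤k))))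

    some-far : ∀ {x y} → dist x y ≡ k → Far x ⊎ Far y
    some-far {x} {y} dxy with far? x | far? y
    ... | yes far | _ = inj₁ far
    ... | no _ | yes far = inj₂ far
    ... | no x-near | no y-near with four-point a b x y
    ...   | inj₁ le = ⊥-elim (too-close dxy le (near x-near a) (near y-near b))
    ...   | inj₂ le = ⊥-elim (too-close dxy le (near y-near a) (near x-near b))

    stuck-pair : ∀ {x y} → dist x y ≡ k → onPath x ≡ true → ¬ Extends y x → ¬ Extends x y →
      onPath y ≡ false × Far x
    stuck-pair {x} {y} dxy x-on stuck-x stuck-y =
      y-off , endpoint-far x-end
      where
      x-end : Endpoint x
      x-end = stuck-on-path (trans (dist-sym y x) dxy) x-on stuck-x
      y-off : onPath y ≡ false
      y-off with true-or-false (onPath y)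
      ... | inj₁ y-on = ⊥-elim (ends-apart dxy x-end (stuck-on-path dxy y-on stuck-y))
      ... | inj₂ y-off = y-off

    classify : ∀ {x y} → dist x y ≡ k →
      Extends x y ⊎ Extends y x ⊎ (onPath y ≡ false × Far x) ⊎ (onPath x ≡ false × Far y)
    classify {x} {y} dxy with extends? x y | extends? y x
    ... | yes ext | _ = inj₁ ext
    ... | no _ | yes ext = inj₂ (inj₁ ext)
    ... | no stuck-y | no stuck-x with true-or-false (onPath x) | true-or-false (onPath y)
    ...   | inj₁ x-on | _ = inj₂ (inj₂ (inj₁ (stuck-pair dxy x-on stuck-x stuck-y)))
    ...   | inj₂ _ | inj₁ y-on = inj₂ (inj₂ (inj₂ (stuck-pair (trans (dist-sym y x) dxy) y-on stuck-y stuck-x)))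
    ...   | inj₂ x-off | inj₂ y-off with some-far dxy
    ...     | inj₁ x-far = inj₂ (inj₂ (inj₁ (y-off , x-far)))
    ...     | inj₂ y-far = inj₂ (inj₂ (inj₂ (x-off , y-far)))

    -- (x, y) charges (x, q) when q is a neighbour of y or y is off the path;
    -- the weight of (x, y) on (p, q) counts charges from either end.
    charge : Fin n → Fin n → Fin n → Fin n → ℕ
    charge x y p q = δ x p * (𝟙 (G y q) + 𝟙 (not (onPath y)))

    weight : Fin n → Fin n → Fin n → Fin n → ℕ
    weight x y p q = charge x y p q + charge y x q p

    charged : ∀ {x y q} → G y q ≡ true ⊎ onPath y ≡ false → 1 ≤ charge x y x q
    charged {x} {y} {q} reason rewrite δ-refl x | +-identityʳ (𝟙 (G y q) + 𝟙 (not (onPath y))) with reason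
    ... | inj₁ Gyq rewrite Gyq = s≤s z≤n
    ... | inj₂ y-off rewrite y-off = m≤n+m 1 (𝟙 (G y q))

    from-x : ∀ {x y q} → G y q ≡ true ⊎ onPath y ≡ false → 1 ≤ weight x y x q
    from-x {x} {y} {q} reason = ≤-trans (charged {x} {y} {q} reason) (m≤m+n (charge x y x q) (charge y x q x))

    from-y : ∀ {x y p} → G x p ≡ true ⊎ onPath x ≡ false → 1 ≤ weight x y p y
    from-y {x} {y} {p} reason = ≤-trans (charged {y} {x} {p} reason) (m≤n+m (charge y x y p) (charge x y p y))

    covered : ∀ {x y} → dist x y ≡ k → ∃₂ λ p q → dist p q ≡ suc k × 1 ≤ weight x y p q
    covered {x} {y} dxy with classify dxy
    ... | inj₁ (c , Gyc , dxc) = x , c , dxc , from-x (inj₁ Gyc)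
    ... | inj₂ (inj₁ (c , Gxc , dyc)) = c , y , trans (dist-sym c y) dyc , from-y (inj₁ Gxc)
    ... | inj₂ (inj₂ (inj₁ (y-off , z , dxz))) = x , z , dxz , from-x (inj₂ y-off)
    ... | inj₂ (inj₂ (inj₂ (x-off , z , dyz))) = z , y , trans (dist-sym z y) dyz , from-y (inj₂ x-off)

    atK : Fin n → Fin n → Bool
    atK x y = ⌊ dist x y ≟ k ⌋

    received : Fin n → Fin n → ℕ
    received p q = ∑[ y < n ] (𝟙 (atK p y) * (𝟙 (G y q) + 𝟙 (not (onPath y))))

    received-charges : ∀ p q → ∑² (λ x y → 𝟙 (atK x y) * charge x y p q) ≡ received p q
    received-charges p q = begin
      ∑² (λ x y → 𝟙 (atK x y) * charge x y p q)
        ≡⟨ ∑²-cong (λ x y → *-exchange (𝟙 (atK x y)) (δ x p) (h y)) ⟩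
      ∑² (λ x y → δ x p * (𝟙 (atK x y) * h y))
        ≡⟨ sum-cong-≗ (λ x → *-distribˡ-sum (δ x p) (λ y → 𝟙 (atK x y) * h y)) ⟨
      ∑[ x < n ] (δ x p * ∑[ y < n ] (𝟙 (atK x y) * h y))
        ≡⟨ ∑-δ p (λ x → ∑[ y < n ] (𝟙 (atK x y) * h y)) ⟩
      received p q ∎
      where
      open ≡-Reasoning
      h : Fin n → ℕ
      h y = 𝟙 (G y q) + 𝟙 (not (onPath y))

    -- For dist p q = k + 1, at most one neighbour of q is at distance k from p,
    -- so (p, q) receives at most 1 + #off.
    received-bound : ∀ {p q} → dist p q ≡ suc k → received p q ≤ 1 + #off
    received-bound {p} {q} dpq = begin
      received p q
        ≡⟨ sum-cong-≗ (λ y → *-distribˡ-+ (𝟙 (atK p y)) (𝟙 (G y q)) (𝟙 (not (onPath y)))) ⟩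
      ∑[ y < n ] (𝟙 (atK p y) * 𝟙 (G y q) + 𝟙 (atK p y) * 𝟙 (not (onPath y)))
        ≡⟨ ∑-distrib-+ (λ y → 𝟙 (atK p y) * 𝟙 (G y q)) (λ y → 𝟙 (atK p y) * 𝟙 (not (onPath y))) ⟩
      ∑[ y < n ] (𝟙 (atK p y) * 𝟙 (G y q)) + ∑[ y < n ] (𝟙 (atK p y) * 𝟙 (not (onPath y)))
        ≤⟨ +-mono-≤ one-parent (∑-mono (λ y → 𝟙*-≤ (atK p y) (𝟙 (not (onPath y))))) ⟩
      1 + #off ∎
      where
      open ≤-Reasoning
      below-q : ∀ {y} → atK p y ≡ true → dist p y ≤ dist p q
      below-q {y} py =
        ≤-trans (≤-reflexive (⌊⌋-sound (dist p y ≟ k) py)) (≤-trans (n≤1+n k) (≤-reflexive (sym dpq)))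
      one-parent : ∑[ y < n ] (𝟙 (atK p y) * 𝟙 (G y q)) ≤ 1
      one-parent = ≤-trans (≤-reflexive (sum-cong-≗ (λ y → 𝟙-∧ (atK p y) (G y q))))
        (∑-atMostOne (λ y → atK p y ∧ G y q) λ y₁ y₂ e₁ e₂ →
          let (py₁ , Gy₁q) = ∧-true e₁ ; (py₂ , Gy₂q) = ∧-true e₂
          in descent-unique p q Gy₁q Gy₂q (below-q py₁) (below-q py₂))

    load : ∀ {p q} → dist p q ≡ suc k → ∑² (λ x y → 𝟙 (atK x y) * weight x y p q) ≤ 2 * (1 + #off)
    load {p} {q} dpq = begin
      ∑² (λ x y → 𝟙 (atK x y) * weight x y p q)
        ≡⟨ ∑²-cong (λ x y → *-distribˡ-+ (𝟙 (atK x y)) (charge x y p q) (charge y x q p)) ⟩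
      ∑² (λ x y → 𝟙 (atK x y) * charge x y p q + 𝟙 (atK x y) * charge y x q p)
        ≡⟨ ∑²-+ (λ x y → 𝟙 (atK x y) * charge x y p q) (λ x y → 𝟙 (atK x y) * charge y x q p) ⟩
      ∑² (λ x y → 𝟙 (atK x y) * charge x y p q) + ∑² (λ x y → 𝟙 (atK x y) * charge y x q p)
        ≡⟨ cong₂ _+_ (received-charges p q) from-other-end ⟩
      received p q + received q p
        ≤⟨ +-mono-≤ (received-bound dpq) (received-bound (trans (dist-sym q p) dpq)) ⟩
      (1 + #off) + (1 + #off)
        ≡⟨ cong ((1 + #off) +_) (+-identityʳ (1 + #off)) ⟨
      2 * (1 + #off) ∎
      where
      open ≤-Reasoning
      from-other-end : ∑² (λ x y → 𝟙 (atK x y) * charge y x q p) ≡ received q p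
      from-other-end = begin-equality
        ∑² (λ x y → 𝟙 (atK x y) * charge y x q p)
          ≡⟨ ∑²-cong (λ x y → cong (λ e → 𝟙 ⌊ e ≟ k ⌋ * charge y x q p) (dist-sym x y)) ⟩
        ∑² (λ x y → 𝟙 (atK y x) * charge y x q p)
          ≡⟨ ∑²-transpose (λ x y → 𝟙 (atK x y) * charge x y q p) ⟩
        ∑² (λ x y → 𝟙 (atK x y) * charge x y q p)
          ≡⟨ received-charges q p ⟩
        received q p ∎

    ratio : ordered k ≤ 2 * (1 + #off) * ordered (suc k)
    ratio = double-counting atK (λ p q → ⌊ dist p q ≟ suc k ⌋) weight (2 * (1 + #off))
      (λ x y xy → let (p , q , dpq , charged-pq) = covered (⌊⌋-sound (dist x y ≟ k) xy)
                  in p , q , ⌊⌋-true (dist p q ≟ suc k) dpq , charged-pq)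
      (λ p q pq → load (⌊⌋-sound (dist p q ≟ suc k) pq))

lemma3 : (n : ℕ) (G : Graph n) → IsTree G → 3 ≤ n → (D : ℕ) → IsDiameter G D →
    (k : ℕ) → 1 ≤ k → k < D → d G k ≤ 2 * (n ∸ D) * d G (suc k)
lemma3 n G tree _ D ((a , b , a-b) , _) k 1≤k k<D = *-cancelˡ-≤ 2 (begin
  2 * d G k                                     ≡⟨ cong (d G k +_) (+-identityʳ (d G k)) ⟩
  d G k + d G k                                 ≡⟨ ordered≡2d k 1≤k ⟨
  ordered k                                     ≤⟨ ratio ⟩
  2 * (1 + #off) * ordered (suc k)              ≤⟨ *-monoˡ-≤ (ordered (suc k)) (*-monoʳ-≤ 2 off-path-bound) ⟩
  2 * (n ∸ D) * ordered (suc k)                 ≡⟨ cong (2 * (n ∸ D) *_) (ordered≡2d (suc k) (s≤s z≤n)) ⟩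
  2 * (n ∸ D) * (d G (suc k) + d G (suc k))     ≡⟨ *-distribˡ-+ (2 * (n ∸ D)) (d G (suc k)) (d G (suc k)) ⟩
  M + M                                         ≡⟨ cong (M +_) (+-identityʳ M) ⟨
  2 * M                                         ∎)
  where
  open Tree G tree
  dab : dist a b ≡ D
  dab = ⌊⌋-sound (dist a b ≟ D) (trans (sym (atDist≡dist D a b)) a-b)
  open Diametral G tree a b D dab
  open Charging k 1≤k k<D
  open ≤-Reasoning
  M : ℕ
  M = 2 * (n ∸ D) * d G (suc k)
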